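{- Let $M_5=\{1,2,3,4,5\}$ and let $\mathcal{F}\subseteq 2^{M_5}$ be a union-closed family with $\emptyset\in\mathcal{F}$ and $\bigcup_{A\in\mathcal{F}}A=M_5$. Let $T(\mathcal{F})=\min\{1\le k\le 5:\ \mathcal{F}\text{ contains a set of cardinality }k\}$. If $T(\mathcal{F})=k\in\{2,3,4,5\}$, then there exist at least $k$ distinct elements $i\in M_5$ such that $|\{A\in\mathcal{F}: i\in A\}|\ge \tfrac12|\mathcal{F}|$.
   Context: A family $\mathcal{F}$ is union-closed if $A\cup B\in\mathcal{F}$ for all $A,B\in\mathcal{F}$. -}

module Defs where

open import Data.Nat using (ℕ; _*_; _≤_)
open import Data.Fin using (Fin)
open import Data.Fin.Subset using (Subset; _∈_; _∪_; ⊥; ∣_∣)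
open import Data.Fin.Subset.Properties using (_∈?_)
open import Data.List using (List; length; filter)
open import Data.List.Membership.Propositional renaming (_∈_ to _∈ˡ_)
open import Data.List.Relation.Unary.Unique.Propositional using (Unique)
open import Data.Product using (Σ; _×_; ∃)
open import Relation.Binary.PropositionalEquality using (_≡_)

-- A family of subsets of M_5 = Fin 5, given as a duplicate-free list.
Family : Set
Family = List (Subset 5)

UnionClosed : Family → Set
UnionClosed F = ∀ {A B} → A ∈ˡ F → B ∈ˡ F → (A ∪ B) ∈ˡ F

CoversM5 : Family → Set
CoversM5 F = ∀ (i : Fin 5) → ∃ λ A → A ∈ˡ F × i ∈ A

degree : Family → Fin 5 → ℕ
degree F i = length (filter (i ∈?_) F)

T≡ : Family → ℕ → Set
T≡ F k = (∃ λ A → A ∈ˡ F × ∣ A ∣ ≡ k) × (∀ {A} → A ∈ˡ F → 1 ≤ ∣ A ∣ → k ≤ ∣ A ∣)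

Abundant : Family → Fin 5 → Set
Abundant F i = length F ≤ 2 * degree F i

-- If no element of a set C is abundant, then
-- summing 2·deg(i) + 1 ≤ |F| over i ∈ C and double counting gives
-- ∑_{A ∈ F} (|C| − 2|C ∩ A|) ≥ |C|.  Now run a finite case analysis on which sets of size k to 4
-- lie in F (F contains ∅ and M₅, no other set of size below k, and is closed under union).  In every
-- case, each set S of fewer than k elements is disjoint from some C for which this inequality already
-- fails for every F consistent with the case, so C contains an abundant element outside S.  Hence the
-- abundant elements do not fit into a set of fewer than k elements.

module Submission where

open import Defs
open import Data.Nat using (ℕ; _≤_)
open import Data.Fin.Subset using (Subset; _∈_; ⊥; ∣_∣)
open import Data.List.Membership.Propositional renaming (_∈_ to _∈ˡ_)
open import Data.List.Relation.Unary.Unique.Propositional using (Unique)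
open import Data.Product using (_×_; ∃; _,_)

open import Data.Bool.Base using (true; false; if_then_else_)
open import Data.Bool.Properties using () renaming (_≟_ to _≟ᵇ_)
open import Data.Empty using (⊥-elim)
open import Data.Fin.Base using (Fin; zero; suc)
open import Data.Fin.Properties using () renaming (any? to ∃?)
open import Data.Fin.Subset using (inside; outside; ⊤; _∩_; _∪_; Empty)
open import Data.Fin.Subset.Properties using (_∈?_; nonempty?; x∈p∩q⁺; x∈p∪q⁺; ⊆⊤; ⊆-antisym)
open import Data.List.Base
  using (List; []; _∷_; [_]; _++_; map; filter; length; allFin; deduplicate; concatMap; drop; upTo)
import Data.List.Membership.DecPropositional as DecMembership
open import Data.List.Membership.Propositional.Properties
  using (∈-filter⁺; ∈-map⁺; ∈-map⁻; ∈-++⁺ˡ; ∈-++⁺ʳ; ∈-++⁻; ∈-∃++; ∈-deduplicate⁻; ∈-allFin)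
open import Data.List.Properties using (map-cong; map-++; map-tabulate)
open import Data.List.Relation.Binary.Subset.Propositional using (_⊆_)
open import Data.List.Relation.Unary.All as All using (All; all?; []; _∷_)
open import Data.List.Relation.Unary.AllPairs using ([]; _∷_)
open import Data.List.Relation.Unary.Any using (Any; any?; here; there)
open import Data.List.Relation.Unary.Unique.DecPropositional.Properties using (deduplicate-!)
open import Data.Nat.Base using (zero; suc; _+_; _*_; _∸_; _<_; z≤n; s≤s)
open import Data.Nat.ListAction using (sum)
open import Data.Nat.ListAction.Properties using (sum-++)
open import Data.Nat.Properties
  using ( _≟_; _≤?_; _<?_; ≤-total; ≰⇒>; <⇒≱; +-assoc; +-identityʳ; +-mono-≤; +-monoˡ-≤; +-monoʳ-≤
        ; +-cancelˡ-≤; *-identityˡ; *-identityʳ; *-zeroʳ; *-distribˡ-+; m+[n∸m]≡n; m≤n⇒m∸n≡0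
        ; +-commutativeSemigroup; module ≤-Reasoning )
open import Algebra.Properties.CommutativeSemigroup +-commutativeSemigroup using (interchange; x∙yz≈y∙xz)
open import Data.Sum.Base using (_⊎_; inj₁; inj₂)
open import Data.Vec.Base using ([]; _∷_; tabulate)
open import Data.Vec.Properties using (≡-dec; lookup∘tabulate; []=⇒lookup; lookup⇒[]=)
open import Function.Base using (id; _∘_; const)
open import Relation.Binary.Definitions using (DecidableEquality)
open import Relation.Binary.PropositionalEquality
  using (_≡_; refl; sym; trans; cong; cong₂; subst; subst₂; module ≡-Reasoning)
open import Relation.Nullary using (¬_; Dec; yes; no; does; contradiction)
open import Relation.Nullary.Decidable using (¬?; _×-dec_; _⊎-dec_; dec-true; map′)

∑ : {A : Set} → List A → (A → ℕ) → ℕ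
∑ xs f = sum (map f xs)

module _ {A : Set} where

  ∑-cong : ∀ xs {f g : A → ℕ} → (∀ x → f x ≡ g x) → ∑ xs f ≡ ∑ xs g
  ∑-cong xs f≗g = cong sum (map-cong f≗g xs)

  ∑-++ : ∀ xs ys (f : A → ℕ) → ∑ (xs ++ ys) f ≡ ∑ xs f + ∑ ys f
  ∑-++ xs ys f = trans (cong sum (map-++ f xs ys)) (sum-++ (map f xs) (map f ys))

  ∑-+ : ∀ xs (f g : A → ℕ) → ∑ xs (λ x → f x + g x) ≡ ∑ xs f + ∑ xs g
  ∑-+ []       f g = refl
  ∑-+ (x ∷ xs) f g =
    trans (cong (f x + g x +_) (∑-+ xs f g)) (interchange (f x) (g x) (∑ xs f) (∑ xs g))

  ∑-*ˡ : ∀ xs c (f : A → ℕ) → ∑ xs (λ x → c * f x) ≡ c * ∑ xs f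
  ∑-*ˡ []       c f = sym (*-zeroʳ c)
  ∑-*ˡ (x ∷ xs) c f =
    trans (cong (c * f x +_) (∑-*ˡ xs c f)) (sym (*-distribˡ-+ c (f x) (∑ xs f)))

  ∑-const : ∀ (xs : List A) c → ∑ xs (const c) ≡ length xs * c
  ∑-const []       c = refl
  ∑-const (x ∷ xs) c = cong (c +_) (∑-const xs c)

  ∑-mono-≤ : ∀ xs {f g : A → ℕ} → (∀ x → f x ≤ g x) → ∑ xs f ≤ ∑ xs g
  ∑-mono-≤ []       f≤g = z≤n
  ∑-mono-≤ (x ∷ xs) f≤g = +-mono-≤ (f≤g x) (∑-mono-≤ xs f≤g)

  ∑-mono-⊆ : ∀ {xs ys} (f : A → ℕ) → Unique xs → xs ⊆ ys → ∑ xs f ≤ ∑ ys f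
  ∑-mono-⊆ {[]}     f _                  _     = z≤n
  ∑-mono-⊆ {x ∷ xs} f (x∉xs ∷ uniqueXs) xs⊆ys with ∈-∃++ (xs⊆ys (here refl))
  ... | ys₁ , ys₂ , refl = begin
    f x + ∑ xs f               ≤⟨ +-monoʳ-≤ (f x) (∑-mono-⊆ f uniqueXs xs⊆ys₁++ys₂) ⟩
    f x + ∑ (ys₁ ++ ys₂) f     ≡⟨ cong (f x +_) (∑-++ ys₁ ys₂ f) ⟩
    f x + (∑ ys₁ f + ∑ ys₂ f)  ≡⟨ x∙yz≈y∙xz (f x) (∑ ys₁ f) (∑ ys₂ f) ⟩
    ∑ ys₁ f + (f x + ∑ ys₂ f)  ≡⟨ ∑-++ ys₁ (x ∷ ys₂) f ⟨
    ∑ (ys₁ ++ x ∷ ys₂) f       ∎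
    where
    open ≤-Reasoning
    xs⊆ys₁++ys₂ : xs ⊆ ys₁ ++ ys₂
    xs⊆ys₁++ys₂ y∈xs with ∈-++⁻ ys₁ (xs⊆ys (there y∈xs))
    ... | inj₁ y∈ys₁         = ∈-++⁺ˡ y∈ys₁
    ... | inj₂ (here refl)   = ⊥-elim (All.lookup x∉xs y∈xs refl)
    ... | inj₂ (there y∈ys₂) = ∈-++⁺ʳ ys₁ y∈ys₂

∑-comm : {A B : Set} (xs : List A) (ys : List B) (f : A → B → ℕ) →
         ∑ xs (λ x → ∑ ys (f x)) ≡ ∑ ys (λ y → ∑ xs (λ x → f x y))
∑-comm []       ys f = sym (trans (∑-const ys 0) (*-zeroʳ (length ys)))
∑-comm (x ∷ xs) ys f =
  trans (cong (∑ ys (f x) +_) (∑-comm xs ys f)) (sym (∑-+ ys (f x) (λ y → ∑ xs (λ x′ → f x′ y))))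

χ : ∀ {n} → Subset n → Fin n → ℕ
χ p i = if does (i ∈? p) then 1 else 0

∑-allFin-suc : ∀ {n} (f : Fin (suc n) → ℕ) → ∑ (allFin (suc n)) f ≡ f zero + ∑ (allFin n) (f ∘ suc)
∑-allFin-suc f =
  cong (λ xs → f zero + sum xs) (trans (map-tabulate suc f) (sym (map-tabulate id (f ∘ suc))))

∣p∣≡∑χ : ∀ {n} (p : Subset n) → ∣ p ∣ ≡ ∑ (allFin n) (χ p)
∣p∣≡∑χ []            = refl
∣p∣≡∑χ (inside ∷ p)  = trans (cong suc (∣p∣≡∑χ p)) (sym (∑-allFin-suc (χ (inside ∷ p))))
∣p∣≡∑χ (outside ∷ p) = trans (∣p∣≡∑χ p) (sym (∑-allFin-suc (χ (outside ∷ p))))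

χ-∩ : ∀ {n} (p q : Subset n) i → χ (p ∩ q) i ≡ χ p i * χ q i
χ-∩ (inside  ∷ p) (inside  ∷ q) zero    = refl
χ-∩ (inside  ∷ p) (outside ∷ q) zero    = refl
χ-∩ (outside ∷ p) (_       ∷ q) zero    = refl
χ-∩ (_       ∷ p) (_       ∷ q) (suc i) = χ-∩ p q i

∣p∩q∣≡∑χ*χ : ∀ {n} (p q : Subset n) → ∣ p ∩ q ∣ ≡ ∑ (allFin n) (λ i → χ p i * χ q i)
∣p∩q∣≡∑χ*χ p q = trans (∣p∣≡∑χ (p ∩ q)) (∑-cong (allFin _) (χ-∩ p q))

degree≡∑χ : ∀ F i → degree F i ≡ ∑ F (λ A → χ A i)
degree≡∑χ []      i = refl
degree≡∑χ (A ∷ F) i with does (i ∈? A)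
... | true  = cong suc (degree≡∑χ F i)
... | false = degree≡∑χ F i

∑χ*degree≡∑∣∩∣ : ∀ F (C : Subset 5) →
                 ∑ (allFin 5) (λ i → χ C i * degree F i) ≡ ∑ F (λ A → ∣ C ∩ A ∣)
∑χ*degree≡∑∣∩∣ F C = begin
  ∑ I (λ i → χ C i * degree F i)         ≡⟨ ∑-cong I (λ i → cong (χ C i *_) (degree≡∑χ F i)) ⟩
  ∑ I (λ i → χ C i * ∑ F (λ A → χ A i))  ≡⟨ ∑-cong I (λ i → ∑-*ˡ F (χ C i) (λ A → χ A i)) ⟨
  ∑ I (λ i → ∑ F (λ A → χ C i * χ A i))  ≡⟨ ∑-comm I F (λ i A → χ C i * χ A i) ⟩
  ∑ F (λ A → ∑ I (λ i → χ C i * χ A i))  ≡⟨ ∑-cong F (∣p∩q∣≡∑χ*χ C) ⟨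
  ∑ F (λ A → ∣ C ∩ A ∣)                  ∎
  where
  open ≡-Reasoning
  I = allFin 5

abundant? : ∀ F i → Dec (Abundant F i)
abundant? F i = length F ≤? 2 * degree F i

nonAbundant-bound : ∀ F (C : Subset 5) → (∀ i → i ∈ C → ¬ Abundant F i) →
                    ∣ C ∣ + 2 * ∑ F (λ A → ∣ C ∩ A ∣) ≤ length F * ∣ C ∣
nonAbundant-bound F C nonAbundant = begin
  ∣ C ∣ + 2 * ∑ F (λ A → ∣ C ∩ A ∣)
    ≡⟨ cong₂ (λ c m → c + 2 * m) (∣p∣≡∑χ C) (sym (∑χ*degree≡∑∣∩∣ F C)) ⟩
  ∑ I (χ C) + 2 * ∑ I (λ i → χ C i * degree F i)
    ≡⟨ cong (∑ I (χ C) +_) (∑-*ˡ I 2 (λ i → χ C i * degree F i)) ⟨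
  ∑ I (χ C) + ∑ I (λ i → 2 * (χ C i * degree F i))
    ≡⟨ ∑-+ I (χ C) (λ i → 2 * (χ C i * degree F i)) ⟨
  ∑ I (λ i → χ C i + 2 * (χ C i * degree F i))
    ≤⟨ ∑-mono-≤ I pointwise ⟩
  ∑ I (λ i → length F * χ C i)
    ≡⟨ ∑-*ˡ I (length F) (χ C) ⟩
  length F * ∑ I (χ C)
    ≡⟨ cong (length F *_) (∣p∣≡∑χ C) ⟨
  length F * ∣ C ∣ ∎
  where
  open ≤-Reasoning
  I = allFin 5
  pointwise : ∀ i → χ C i + 2 * (χ C i * degree F i) ≤ length F * χ C i
  pointwise i with i ∈? C
  ... | yes i∈C = subst₂ _≤_ (cong (λ d → suc (2 * d)) (sym (*-identityˡ (degree F i))))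
                             (sym (*-identityʳ (length F))) (≰⇒> (nonAbundant i i∈C))
  ... | no  _   = z≤n

-- |C| − 2|C ∩ A|, which may be negative, as deficit C A − excess C A.
deficit excess : ∀ {n} → Subset n → Subset n → ℕ
deficit C A = ∣ C ∣ ∸ 2 * ∣ C ∩ A ∣
excess  C A = 2 * ∣ C ∩ A ∣ ∸ ∣ C ∣

m+[n∸m]≡n+[m∸n] : ∀ m n → m + (n ∸ m) ≡ n + (m ∸ n)
m+[n∸m]≡n+[m∸n] m n with ≤-total m n
... | inj₁ m≤n = trans (m+[n∸m]≡n m≤n) (sym (trans (cong (n +_) (m≤n⇒m∸n≡0 m≤n)) (+-identityʳ n)))
... | inj₂ n≤m = trans (trans (cong (m +_) (m≤n⇒m∸n≡0 n≤m)) (+-identityʳ m)) (sym (m+[n∸m]≡n n≤m))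

nonAbundant⇒excess≤deficit : ∀ F (C : Subset 5) → (∀ i → i ∈ C → ¬ Abundant F i) →
                             ∣ C ∣ + ∑ F (excess C) ≤ ∑ F (deficit C)
nonAbundant⇒excess≤deficit F C nonAbundant = +-cancelˡ-≤ total _ _ (begin
  total + (∣ C ∣ + ∑ F (excess C))    ≡⟨ x∙yz≈y∙xz total ∣ C ∣ (∑ F (excess C)) ⟩
  ∣ C ∣ + (total + ∑ F (excess C))    ≡⟨ cong (∣ C ∣ +_) balance ⟨
  ∣ C ∣ + (shared + ∑ F (deficit C))  ≡⟨ +-assoc ∣ C ∣ shared (∑ F (deficit C)) ⟨
  ∣ C ∣ + shared + ∑ F (deficit C)    ≤⟨ +-monoˡ-≤ (∑ F (deficit C)) bound ⟩
  total + ∑ F (deficit C)             ∎)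
  where
  open ≤-Reasoning
  total shared : ℕ
  total = ∑ F (const ∣ C ∣)
  shared = ∑ F (λ A → 2 * ∣ C ∩ A ∣)
  balance : shared + ∑ F (deficit C) ≡ total + ∑ F (excess C)
  balance = trans (sym (∑-+ F (λ A → 2 * ∣ C ∩ A ∣) (deficit C)))
                  (trans (∑-cong F (λ A → m+[n∸m]≡n+[m∸n] (2 * ∣ C ∩ A ∣) ∣ C ∣))
                         (∑-+ F (const ∣ C ∣) (excess C)))
  bound : ∣ C ∣ + shared ≤ total
  bound = begin
    ∣ C ∣ + shared                     ≡⟨ cong (∣ C ∣ +_) (∑-*ˡ F 2 (λ A → ∣ C ∩ A ∣)) ⟩
    ∣ C ∣ + 2 * ∑ F (λ A → ∣ C ∩ A ∣)  ≤⟨ nonAbundant-bound F C nonAbundant ⟩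
    length F * ∣ C ∣                   ≡⟨ ∑-const F ∣ C ∣ ⟨
    total                              ∎

-- Since In ⊆ F ⊆ Possible, this forces ∑ F (deficit C) < ∣ C ∣ + ∑ F (excess C).
Refutes : List (Subset 5) → List (Subset 5) → Subset 5 → Set
Refutes In Possible C = ∑ Possible (deficit C) < ∣ C ∣ + ∑ In (excess C)

certificate⇒abundant : ∀ {F In Possible} (C : Subset 5) → Unique F → Unique In → In ⊆ F → F ⊆ Possible →
                       Refutes In Possible C → ∃ λ i → i ∈ C × Abundant F i
certificate⇒abundant {F} {In} {Possible} C uniqueF uniqueIn In⊆F F⊆Possible refutes
  with ∃? (λ i → i ∈? C ×-dec abundant? F i)
... | yes found = found
... | no  none  = contradiction (begin
  ∣ C ∣ + ∑ In (excess C)  ≤⟨ +-monoʳ-≤ ∣ C ∣ (∑-mono-⊆ (excess C) uniqueIn In⊆F) ⟩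
  ∣ C ∣ + ∑ F (excess C)   ≤⟨ nonAbundant⇒excess≤deficit F C (λ i i∈C abundant → none (i , i∈C , abundant)) ⟩
  ∑ F (deficit C)          ≤⟨ ∑-mono-⊆ (deficit C) uniqueF F⊆Possible ⟩
  ∑ Possible (deficit C)   ∎) (<⇒≱ refutes)
  where open ≤-Reasoning

does≡true⇒ : ∀ {A : Set} (a? : Dec A) → does a? ≡ true → A
does≡true⇒ (yes a) _ = a

abundantSet : Family → Subset 5
abundantSet F = tabulate (λ i → does (abundant? F i))

∈-abundantSet⁺ : ∀ {F i} → Abundant F i → i ∈ abundantSet F
∈-abundantSet⁺ {F} {i} abundant =
  lookup⇒[]= i (abundantSet F) (trans (lookup∘tabulate (λ j → does (abundant? F j)) i) (dec-true (abundant? F i) abundant))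

∈-abundantSet⁻ : ∀ {F i} → i ∈ abundantSet F → Abundant F i
∈-abundantSet⁻ {F} {i} i∈S =
  does≡true⇒ (abundant? F i) (trans (sym (lookup∘tabulate (λ j → does (abundant? F j)) i)) ([]=⇒lookup i∈S))

HasAbundantSet : Family → ℕ → Set
HasAbundantSet F k = ∃ λ (S : Subset 5) → k ≤ ∣ S ∣ × (∀ i → i ∈ S → Abundant F i)

_≟ˢ_ : ∀ {n} → DecidableEquality (Subset n)
_≟ˢ_ = ≡-dec _≟ᵇ_

open DecMembership (_≟ˢ_ {5}) using () renaming (_∈?_ to _∈ˡ?_; _∉?_ to _∉ˡ?_)

extend : Subset 5 → List (Subset 5) → List (Subset 5)
extend s In = deduplicate _≟ˢ_ (s ∷ map (s ∪_) In ++ In)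

module Search (candidates certificates smallSets : List (Subset 5)) where

  possible : List (Subset 5) → List (Subset 5)
  possible Out = filter (_∉ˡ? Out) candidates

  SmallSetsExcluded : List (Subset 5) → List (Subset 5) → Set
  SmallSetsExcluded In Possible =
    All (λ S → Any (λ C → Empty (C ∩ S) × Refutes In Possible C) certificates) smallSets

  smallSetsExcluded? : ∀ In Possible → Dec (SmallSetsExcluded In Possible)
  smallSetsExcluded? In Possible =
    all? (λ S → any? (λ C → ¬? (nonempty? (C ∩ S)) ×-dec (_ <? _)) certificates) smallSets

  Closed : List (Subset 5) → List (Subset 5) → Set
  Closed In Out = Any (_∈ˡ Out) In ⊎ SmallSetsExcluded In (possible Out)

  closed? : ∀ In Out → Dec (Closed In Out)
  closed? In Out = any? (_∈ˡ? Out) In ⊎-dec smallSetsExcluded? In (possible Out)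

  data AllBranchesClose : List (Subset 5) → List (Subset 5) → List (Subset 5) → Set where
    stop   : ∀ {bs In Out} → Closed In Out → AllBranchesClose bs In Out
    branch : ∀ {s bs In Out} → AllBranchesClose bs (extend s In) Out → AllBranchesClose bs In (s ∷ Out) →
             AllBranchesClose (s ∷ bs) In Out

  allBranchesClose? : ∀ bs In Out → Dec (AllBranchesClose bs In Out)
  allBranchesClose? []       In Out = map′ stop (λ { (stop closed) → closed }) (closed? In Out)
  allBranchesClose? (s ∷ bs) In Out =
    map′ (λ { (inj₁ closed) → stop closed ; (inj₂ (l , r)) → branch l r })
         (λ { (stop closed) → inj₁ closed ; (branch l r) → inj₂ (l , r) })
         (closed? In Out ⊎-dec (allBranchesClose? bs (extend s In) Out ×-dec allBranchesClose? bs In (s ∷ Out)))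

  module Sound (F : Family) (k : ℕ) (uniqueF : Unique F) (closedF : UnionClosed F)
               (F⊆candidates : F ⊆ candidates) (smallSets-complete : ∀ S → ∣ S ∣ < k → S ∈ˡ smallSets) where

    record Consistent (In Out : List (Subset 5)) : Set where
      field
        unique : Unique In
        In⊆F   : In ⊆ F
        Out∌F  : ∀ {A} → A ∈ˡ Out → ¬ A ∈ˡ F
    open Consistent

    F⊆possible : ∀ {In Out} → Consistent In Out → F ⊆ possible Out
    F⊆possible c A∈F = ∈-filter⁺ (_∉ˡ? _) (F⊆candidates A∈F) (λ A∈Out → Out∌F c A∈Out A∈F)

    extend-consistent : ∀ {s In Out} → s ∈ˡ F → Consistent In Out → Consistent (extend s In) Out
    extend-consistent {s} {In} s∈F c = record
      { unique = deduplicate-! _≟ˢ_ generated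
      ; In⊆F   = generated⊆F ∘ ∈-deduplicate⁻ _≟ˢ_ generated
      ; Out∌F  = Out∌F c
      }
      where
      generated : List (Subset 5)
      generated = s ∷ map (s ∪_) In ++ In
      generated⊆F : generated ⊆ F
      generated⊆F (here refl) = s∈F
      generated⊆F (there A∈) with ∈-++⁻ (map (s ∪_) In) A∈
      ... | inj₂ A∈In  = In⊆F c A∈In
      ... | inj₁ A∈s∪In with ∈-map⁻ (s ∪_) A∈s∪In
      ...   | t , t∈In , refl = closedF s∈F (In⊆F c t∈In)

    exclude-consistent : ∀ {s In Out} → ¬ s ∈ˡ F → Consistent In Out → Consistent In (s ∷ Out)
    exclude-consistent s∉F c = record
      { unique = unique c
      ; In⊆F   = In⊆F c
      ; Out∌F  = λ { (here refl) → s∉F ; (there A∈Out) → Out∌F c A∈Out }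
      }

    closed⇒abundantSet : ∀ {In Out} → Consistent In Out → Closed In Out → HasAbundantSet F k
    closed⇒abundantSet c (inj₁ conflict) with find conflict
    ... | A , A∈In , A∈Out = contradiction (In⊆F c A∈In) (Out∌F c A∈Out)
    closed⇒abundantSet c (inj₂ excluded) with k ≤? ∣ abundantSet F ∣
    ... | yes large = abundantSet F , large , λ _ → ∈-abundantSet⁻ {F}
    ... | no  small with find (All.lookup excluded (smallSets-complete _ (≰⇒> small)))
    ...   | C , _ , disjoint , refutes
              with certificate⇒abundant C uniqueF (unique c) (In⊆F c) (F⊆possible c) refutes
    ...     | i , i∈C , abundant = contradiction (i , x∈p∩q⁺ (i∈C , ∈-abundantSet⁺ {F} abundant)) disjoint

    branches⇒abundantSet : ∀ {bs In Out} → Consistent In Out → AllBranchesClose bs In Out → HasAbundantSet F k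
    branches⇒abundantSet c (stop closed) = closed⇒abundantSet c closed
    branches⇒abundantSet {s ∷ _} c (branch withS withoutS) with s ∈ˡ? F
    ... | yes s∈F = branches⇒abundantSet (extend-consistent s∈F c) withS
    ... | no  s∉F = branches⇒abundantSet (exclude-consistent s∉F c) withoutS

allSubsets : ∀ n → List (Subset n)
allSubsets zero    = [ [] ]
allSubsets (suc n) = map (inside ∷_) (allSubsets n) ++ map (outside ∷_) (allSubsets n)

∈-allSubsets : ∀ {n} (p : Subset n) → p ∈ˡ allSubsets n
∈-allSubsets []            = here refl
∈-allSubsets (inside ∷ p)  = ∈-++⁺ˡ (∈-map⁺ (inside ∷_) (∈-allSubsets p))
∈-allSubsets (outside ∷ p) = ∈-++⁺ʳ (map (inside ∷_) (allSubsets _)) (∈-map⁺ (outside ∷_) (∈-allSubsets p))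

subsetsOfSize : ℕ → List (Subset 5)
subsetsOfSize j = filter (λ s → ∣ s ∣ ≟ j) (allSubsets 5)

candidates : ℕ → List (Subset 5)
candidates k = filter (λ s → ∣ s ∣ ≟ 0 ⊎-dec k ≤? ∣ s ∣) (allSubsets 5)

smallSets : ℕ → List (Subset 5)
smallSets k = filter (λ s → ∣ s ∣ <? k) (allSubsets 5)

-- Soundness holds for any certificates and branching order; these choices make every case close.
certificates : ℕ → List (Subset 5)
certificates k = subsetsOfSize 2 ++ subsetsOfSize (6 ∸ k)

branchSets : ℕ → List (Subset 5)
branchSets k = concatMap subsetsOfSize (drop k (upTo 5))

module Cases (k : ℕ) = Search (candidates k) (certificates k) (smallSets k)

branches-close : ∀ k → 2 ≤ k → k ≤ 5 → Cases.AllBranchesClose k (branchSets k) (⊤ ∷ ⊥ ∷ []) []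
branches-close 2 _ _ = does≡true⇒ (Cases.allBranchesClose? 2 (branchSets 2) (⊤ ∷ ⊥ ∷ []) []) refl
branches-close 3 _ _ = does≡true⇒ (Cases.allBranchesClose? 3 (branchSets 3) (⊤ ∷ ⊥ ∷ []) []) refl
branches-close 4 _ _ = does≡true⇒ (Cases.allBranchesClose? 4 (branchSets 4) (⊤ ∷ ⊥ ∷ []) []) refl
branches-close 5 _ _ = does≡true⇒ (Cases.allBranchesClose? 5 (branchSets 5) (⊤ ∷ ⊥ ∷ []) []) refl
branches-close 0 () _
branches-close 1 (s≤s ()) _
branches-close (suc (suc (suc (suc (suc (suc _)))))) _ (s≤s (s≤s (s≤s (s≤s (s≤s ())))))

F⊆candidates : ∀ {F k} → (∀ {A} → A ∈ˡ F → 1 ≤ ∣ A ∣ → k ≤ ∣ A ∣) → F ⊆ candidates k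
F⊆candidates {k = k} minimal {A} A∈F =
  ∈-filter⁺ (λ s → ∣ s ∣ ≟ 0 ⊎-dec k ≤? ∣ s ∣) (∈-allSubsets A) (emptyOrLarge ∣ A ∣ (minimal A∈F))
  where
  emptyOrLarge : ∀ n → (1 ≤ n → k ≤ n) → n ≡ 0 ⊎ k ≤ n
  emptyOrLarge zero    _     = inj₁ refl
  emptyOrLarge (suc n) large = inj₂ (large (s≤s z≤n))

∈-smallSets : ∀ k S → ∣ S ∣ < k → S ∈ˡ smallSets k
∈-smallSets k S = ∈-filter⁺ (λ s → ∣ s ∣ <? k) (∈-allSubsets S)

union-of-cover : ∀ {F} → UnionClosed F → ⊥ ∈ˡ F → CoversM5 F →
                 (is : List (Fin 5)) → ∃ λ A → A ∈ˡ F × (∀ {i} → i ∈ˡ is → i ∈ A)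
union-of-cover closed ∅∈F covers []       = ⊥ , ∅∈F , λ ()
union-of-cover closed ∅∈F covers (i ∷ is) with covers i | union-of-cover closed ∅∈F covers is
... | B , B∈F , i∈B | A , A∈F , is⊆A = B ∪ A , closed B∈F A∈F , λ
  { (here refl)   → x∈p∪q⁺ (inj₁ i∈B)
  ; (there j∈is) → x∈p∪q⁺ (inj₂ (is⊆A j∈is)) }

⊤∈F : ∀ {F} → UnionClosed F → ⊥ ∈ˡ F → CoversM5 F → ⊤ ∈ˡ F
⊤∈F closed ∅∈F covers with union-of-cover closed ∅∈F covers (allFin 5)
... | A , A∈F , all∈A = subst (_∈ˡ _) (⊆-antisym ⊆⊤ (λ {i} _ → all∈A (∈-allFin i))) A∈F

mainTheorem5 : (F : Family) → Unique F → UnionClosed F → ⊥ ∈ˡ F → CoversM5 F →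
    (k : ℕ) → 2 ≤ k → k ≤ 5 → T≡ F k →
    ∃ λ (S : Subset 5) → k ≤ ∣ S ∣ × (∀ i → i ∈ S → Abundant F i)
mainTheorem5 F uniqueF closedF ∅∈F covers k 2≤k k≤5 (_ , minimal) =
  branches⇒abundantSet initial (branches-close k 2≤k k≤5)
  where
  open Cases k
  open Sound F k uniqueF closedF (F⊆candidates minimal) (∈-smallSets k)
  initial : Consistent (⊤ ∷ ⊥ ∷ []) []
  initial = record
    { unique = ((λ ()) ∷ []) ∷ [] ∷ []
    ; In⊆F   = λ { (here refl) → ⊤∈F closedF ∅∈F covers ; (there (here refl)) → ∅∈F }
    ; Out∌F  = λ ()
    }
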